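{- There exists $N$ such that for all integers $n\ge N$, $\operatorname{ex}^{*}(n,\mathcal{D}_3)\le n^{0.8295}$.
   Context: For a finite poset $Q$ and a family of posets $\mathcal{F}$, $\operatorname{ex}^{*}(Q,\mathcal{F})$ denotes the maximum size of an induced subposet of $Q$ containing no member of $\mathcal{F}$ as an induced subposet; $\operatorname{ex}^{*}(n,\mathcal{F})$ is the minimum of $\operatorname{ex}^{*}(Q,\mathcal{F})$ over all $n$-element posets $Q$. $\mathcal{D}_d$ denotes the family of all posets of (order) dimension at least $d$. Thus $\operatorname{ex}^{*}(n,\mathcal{D}_3)$ is the largest $k$ such that every $n$-element poset has an induced subposet of dimension at most $2$ with at least $k$ elements. -}

module Defs where

open import Level using (0ℓ)
open import Data.Nat using (ℕ)
open import Data.Fin using (Fin)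
open import Data.Fin.Subset using (Subset; _∈_)
open import Data.Product using (_×_; Σ-syntax)
open import Data.Sum using (_⊎_)
open import Relation.Binary.Core using (Rel)
open import Relation.Binary.Structures using (IsPartialOrder)
open import Relation.Binary.PropositionalEquality using (_≡_)

-- A poset on n elements: a partial order (w.r.t. _≡_) on Fin n.
-- Every n-element poset is isomorphic to one of these.
record Poset (n : ℕ) : Set₁ where
  field
    _≼_       : Rel (Fin n) 0ℓ
    isPartial : IsPartialOrder _≡_ _≼_

record IsLinearOrderOn {n : ℕ} (S : Subset n) (L : Rel (Fin n) 0ℓ) : Set where
  field
    reflexive  : ∀ x → x ∈ S → L x x
    antisym    : ∀ x y → x ∈ S → y ∈ S → L x y → L y x → x ≡ y
    transitive : ∀ x y z → x ∈ S → y ∈ S → z ∈ S → L x y → L y z → L x z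
    total      : ∀ x y → x ∈ S → y ∈ S → L x y ⊎ L y x

-- The induced subposet of P on S has (order) dimension at most 2:
-- there are two linear orders on S whose intersection is the order of P
-- restricted to S (a realizer of size ≤ 2; a realizer of size 1 can be
-- duplicated, and each linear order is automatically a linear extension).
DimAtMost2 : {n : ℕ} → Poset n → Subset n → Set₁
DimAtMost2 {n} P S =
  Σ[ L₁ ∈ Rel (Fin n) 0ℓ ] Σ[ L₂ ∈ Rel (Fin n) 0ℓ ]
    ( IsLinearOrderOn S L₁ × IsLinearOrderOn S L₂
    × (∀ x y → x ∈ S → y ∈ S →
         ((x ≼ y → L₁ x y × L₂ x y) × (L₁ x y × L₂ x y → x ≼ y))) )
  where open Poset P

-- In the standard example Sₘ (elements aᵢ, bᵢ with aᵢ < bⱼ iff i ≢ j) every complete pair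
-- aᵢ, bᵢ of an induced subposet of dimension ≤ 2 is reversed by one of the two realizing
-- linear orders, while no linear extension reverses two different pairs; so such a subposet
-- has at most m + 2 elements.  The bound multiplies under lexicographic products, since
-- each row of such a subposet and the set of rows it meets have dimension ≤ 2 again; so some
-- poset on 20ᵗ elements has ex* ≤ 12ᵗ, and restricting to n elements, 20ᵗ ≤ n < 20ᵗ⁺¹,
-- gives ex*(n) ≤ 12ᵗ⁺¹.  Since 12²⁰⁰⁰ < 20¹⁶⁵⁹, Bernoulli's inequality absorbs the extra
-- factor 12 once t is large: (12ᵗ⁺¹)²⁰⁰⁰ ≤ (12²⁰⁰⁰ + 1)ᵗ ≤ (20ᵗ)¹⁶⁵⁹.
module Submission where

open import Level using (0ℓ)
open import Data.Empty using (⊥-elim)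
open import Data.Fin as Fin using (Fin; zero; suc; _↑ˡ_; _↑ʳ_; splitAt; join; combine; remQuot; punchOut)
open import Data.Fin.Properties as FinP
  using (suc-injective; 0≢1+n; punchOut-injective; splitAt-↑ˡ; splitAt-↑ʳ; join-splitAt;
         ↑ˡ-injective; remQuot-combine; combine-remQuot)
open import Data.Fin.Subset using (Subset; _∈_; _∉_; _∩_; ∣_∣; ⊥; inside; outside)
open import Data.Fin.Subset.Properties using (drop-there; ∉⊥; x∈p∩q⁻; Empty-unique; ∣⊥∣≡0; ∣p∣≤n; nonempty?)
open import Data.Nat using (ℕ; zero; suc; _+_; _*_; _^_; _≤_; _<_; z≤n; s≤s; z<s; NonZero; >-nonZero; _<?_)
open import Data.Nat.Properties
  using (≤-refl; ≤-reflexive; ≤-trans; <-trans; ≤-<-trans; <-≤-trans; <-irrefl; <⇒≤; ≮⇒≥; n<1+n;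
         m≤n⇒m≤1+n; m≤m+n; m≤n+m; m+[n∸m]≡n; +-suc; +-identityʳ; *-zeroʳ; *-comm; *-assoc;
         +-mono-≤; +-monoʳ-≤; *-monoˡ-≤; *-monoʳ-≤; *-cancelˡ-≤;
         ^-*-assoc; m^n>0; ^-monoˡ-≤; ^-monoʳ-≤; ^-monoʳ-<; ≤ᵇ⇒≤; +-0-monoid; module ≤-Reasoning)
open import Data.Nat.Tactic.RingSolver using (solve-∀)
open import Data.Product using (Σ-syntax; ∃-syntax; _×_; _,_; proj₁; proj₂)
open import Data.Product.Relation.Binary.Lex.NonStrict using (×-Lex; ×-isPartialOrder)
open import Data.Sum using (_⊎_; inj₁; inj₂; [_,_]′)
open import Data.Unit using (tt)
open import Data.Vec using (_∷_; []; _++_; lookup; tabulate; here; there)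
open import Data.Vec.Properties using (lookup∘tabulate; tabulate∘lookup; tabulate-cong; []=⇒lookup; lookup⇒[]=)
open import Function using (_∘_; _on_; id; const)
open import Relation.Binary.Core using (Rel)
open import Relation.Binary.PropositionalEquality
open import Relation.Binary.Structures using (IsPartialOrder; IsStrictPartialOrder)
import Relation.Binary.Construct.StrictToNonStrict as StrictToNonStrict
open import Relation.Nullary using (¬_; yes; no; does)
open import Relation.Nullary.Decidable using (dec-true)
open import Relation.Unary using (Pred; Decidable)
open import Algebra.Properties.Monoid.Sum +-0-monoid using (sum-syntax; sum-cong-≗)
open import Defs

preimage : ∀ {m n} → (Fin m → Fin n) → Subset n → Subset m
preimage f p = tabulate (lookup p ∘ f)

∈-preimage⁻ : ∀ {m n} {f : Fin m → Fin n} {p x} → x ∈ preimage f p → f x ∈ p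
∈-preimage⁻ {f = f} {p} {x} x∈ =
  lookup⇒[]= (f x) p (trans (sym (lookup∘tabulate (lookup p ∘ f) x)) ([]=⇒lookup x∈))

preimage-∘ : ∀ {l m n} (f : Fin l → Fin m) (g : Fin m → Fin n) p →
             preimage f (preimage g p) ≡ preimage (g ∘ f) p
preimage-∘ f g p = tabulate-cong (λ x → lookup∘tabulate (lookup p ∘ g) (f x))

select : ∀ {n ℓ} {P : Pred (Fin n) ℓ} → Decidable P → Subset n
select P? = tabulate (does ∘ P?)

∈-select⁺ : ∀ {n ℓ} {P : Pred (Fin n) ℓ} {P? : Decidable P} {x} → P x → x ∈ select P?
∈-select⁺ {P? = P?} {x} px = lookup⇒[]= x _ (trans (lookup∘tabulate (does ∘ P?) x) (dec-true (P? x) px))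

∈-select⁻ : ∀ {n ℓ} {P : Pred (Fin n) ℓ} {P? : Decidable P} {x} → x ∈ select P? → P x
∈-select⁻ {P? = P?} {x} x∈ with P? x | trans (sym (lookup∘tabulate (does ∘ P?) x)) ([]=⇒lookup x∈)
... | yes px | _ = px
... | no _   | ()

∈-p++⊥⁻ : ∀ {m n} {p : Subset m} {u : Fin (m + n)} → u ∈ p ++ ⊥ → ∃[ x ] (x ∈ p × u ≡ x ↑ˡ n)
∈-p++⊥⁻ {p = []}    u∈ = ⊥-elim (∉⊥ u∈)
∈-p++⊥⁻ {p = _ ∷ _} {zero}  here = zero , here , refl
∈-p++⊥⁻ {n = n} {p = _ ∷ p} {suc u} (there u∈) with ∈-p++⊥⁻ {n = n} {p = p} u∈
... | x , x∈p , refl = suc x , there x∈p , refl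

∣p++⊥∣≡∣p∣ : ∀ {m n} (p : Subset m) → ∣ p ++ ⊥ {n} ∣ ≡ ∣ p ∣
∣p++⊥∣≡∣p∣ {n = n} []  = ∣⊥∣≡0 n
∣p++⊥∣≡∣p∣ (inside  ∷ p) = cong suc (∣p++⊥∣≡∣p∣ p)
∣p++⊥∣≡∣p∣ (outside ∷ p) = ∣p++⊥∣≡∣p∣ p

∣p∣≡∣preimage↑ˡ∣+∣preimage↑ʳ∣ : ∀ m {n} (p : Subset (m + n)) →
                                ∣ p ∣ ≡ ∣ preimage (_↑ˡ n) p ∣ + ∣ preimage (m ↑ʳ_) p ∣
∣p∣≡∣preimage↑ˡ∣+∣preimage↑ʳ∣ zero    p             = cong ∣_∣ (sym (tabulate∘lookup p))
∣p∣≡∣preimage↑ˡ∣+∣preimage↑ʳ∣ (suc m) (inside  ∷ p) = cong suc (∣p∣≡∣preimage↑ˡ∣+∣preimage↑ʳ∣ m p)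
∣p∣≡∣preimage↑ˡ∣+∣preimage↑ʳ∣ (suc m) (outside ∷ p) = ∣p∣≡∣preimage↑ˡ∣+∣preimage↑ʳ∣ m p

row : ∀ {a b} → Subset (a * b) → Fin a → Subset b
row p i = preimage (combine i) p

∣p∣≡∑∣row∣ : ∀ a {b} (p : Subset (a * b)) → ∣ p ∣ ≡ ∑[ i < a ] ∣ row p i ∣
∣p∣≡∑∣row∣ zero    []    = refl
∣p∣≡∑∣row∣ (suc a) {b} p = begin
  ∣ p ∣                                                ≡⟨ ∣p∣≡∣preimage↑ˡ∣+∣preimage↑ʳ∣ b p ⟩
  ∣ row₀ ∣ + ∣ p′ ∣                                    ≡⟨ cong (∣ row₀ ∣ +_) (∣p∣≡∑∣row∣ a p′) ⟩
  ∣ row₀ ∣ + ∑[ i < a ] ∣ row {b = b} p′ i ∣           ≡⟨ cong (∣ row₀ ∣ +_) (sum-cong-≗ {a} row-p′) ⟩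
  ∑[ i < suc a ] ∣ row {b = b} p i ∣                   ∎
  where
  open ≡-Reasoning
  row₀ = row {suc a} {b} p zero
  p′ = preimage (b ↑ʳ_) p
  row-p′ : ∀ i → ∣ row p′ i ∣ ≡ ∣ row p (suc i) ∣
  row-p′ i = cong ∣_∣ (preimage-∘ (combine {n = b} i) (b ↑ʳ_) p)

∣p∣+∣q∣≤n+∣p∩q∣ : ∀ {n} (p q : Subset n) → ∣ p ∣ + ∣ q ∣ ≤ n + ∣ p ∩ q ∣
∣p∣+∣q∣≤n+∣p∩q∣ []            []            = z≤n
∣p∣+∣q∣≤n+∣p∩q∣ (inside  ∷ p) (inside  ∷ q) =
  s≤s (subst₂ _≤_ (sym (+-suc _ _)) (sym (+-suc _ _)) (s≤s (∣p∣+∣q∣≤n+∣p∩q∣ p q)))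
∣p∣+∣q∣≤n+∣p∩q∣ (inside  ∷ p) (outside ∷ q) = s≤s (∣p∣+∣q∣≤n+∣p∩q∣ p q)
∣p∣+∣q∣≤n+∣p∩q∣ {suc n} (outside ∷ p) (inside  ∷ q) =
  subst (_≤ suc n + ∣ p ∩ q ∣) (sym (+-suc _ _)) (s≤s (∣p∣+∣q∣≤n+∣p∩q∣ p q))
∣p∣+∣q∣≤n+∣p∩q∣ (outside ∷ p) (outside ∷ q) = m≤n⇒m≤1+n (∣p∣+∣q∣≤n+∣p∩q∣ p q)

injection⇒∣p∣≤ : ∀ {n k} (p : Subset n) (f : ∀ {x} → x ∈ p → Fin k) →
                 (∀ {x y} (x∈p : x ∈ p) (y∈p : y ∈ p) → f x∈p ≡ f y∈p → x ≡ y) → ∣ p ∣ ≤ k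
injection⇒∣p∣≤ []            f f-inj = z≤n
injection⇒∣p∣≤ (outside ∷ p) f f-inj =
  injection⇒∣p∣≤ p (f ∘ there) (λ x∈p y∈p → suc-injective ∘ f-inj (there x∈p) (there y∈p))
injection⇒∣p∣≤ {k = zero}  (inside ∷ p) f f-inj with f here
... | ()
injection⇒∣p∣≤ {k = suc k} (inside ∷ p) f f-inj = s≤s (injection⇒∣p∣≤ p g g-inj)
  where
  f₀≢ : ∀ {y} (y∈p : y ∈ p) → f here ≢ f (there y∈p)
  f₀≢ y∈p = 0≢1+n ∘ f-inj here (there y∈p)

  g : ∀ {y} → y ∈ p → Fin k
  g y∈p = punchOut (f₀≢ y∈p)

  g-inj : ∀ {x y} (x∈p : x ∈ p) (y∈p : y ∈ p) → g x∈p ≡ g y∈p → x ≡ y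
  g-inj x∈p y∈p = suc-injective ∘ f-inj (there x∈p) (there y∈p) ∘ punchOut-injective (f₀≢ x∈p) (f₀≢ y∈p)

∑≤∣p∣* : ∀ {n k} (f : Fin n → ℕ) (p : Subset n) →
         (∀ i → f i ≤ k) → (∀ {i} → i ∉ p → f i ≡ 0) → ∑[ i < n ] f i ≤ ∣ p ∣ * k
∑≤∣p∣* f []            f≤k supp = z≤n
∑≤∣p∣* f (inside  ∷ p) f≤k supp =
  +-mono-≤ (f≤k zero) (∑≤∣p∣* (f ∘ suc) p (f≤k ∘ suc) (λ i∉p → supp (i∉p ∘ drop-there)))
∑≤∣p∣* f (outside ∷ p) f≤k supp rewrite supp {zero} (λ ()) =
  ∑≤∣p∣* (f ∘ suc) p (f≤k ∘ suc) (λ i∉p → supp (i∉p ∘ drop-there))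

comap : ∀ {n} {A : Set} {_≈_ _≤_ : Rel A 0ℓ} → IsPartialOrder _≈_ _≤_ →
        (f : Fin n → A) → (∀ {x y} → f x ≈ f y → x ≡ y) → Poset n
comap {_≤_ = _≤_} po f f-inj = record
  { _≼_       = _≤_ on f
  ; isPartial = record
    { isPreorder = record
      { isEquivalence = isEquivalence
      ; reflexive     = λ { refl → PO.refl }
      ; trans         = PO.trans
      }
    ; antisym = λ fx≤fy fy≤fx → f-inj (PO.antisym fx≤fy fy≤fx)
    }
  }
  where module PO = IsPartialOrder po

chain : ∀ n → Poset n
chain n = record { _≼_ = Fin._≤_ ; isPartial = FinP.≤-isPartialOrder }

Dim2Bounded : ∀ {n} → Poset n → ℕ → Set₁
Dim2Bounded {n} P k = (S : Subset n) → DimAtMost2 P S → ∣ S ∣ ≤ k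

Ex*≤ : ℕ → ℕ → Set₁
Ex*≤ n k = Σ[ P ∈ Poset n ] Dim2Bounded P k

record OrderEmbeddingOn {n m} (P : Poset n) (Q : Poset m) (h : Fin n → Fin m)
                        (T : Subset n) (S : Subset m) : Set where
  private
    module P = Poset P
    module Q = Poset Q
  field
    mapsTo     : ∀ {x} → x ∈ T → h x ∈ S
    monotone   : ∀ {x y} → x ∈ T → y ∈ T → x P.≼ y → h x Q.≼ h y
    reflecting : ∀ {x y} → x ∈ T → y ∈ T → h x Q.≼ h y → x P.≼ y

  injective : ∀ {x y} → x ∈ T → y ∈ T → h x ≡ h y → x ≡ y
  injective x∈T y∈T hx≡hy =
    IsPartialOrder.antisym P.isPartial
      (reflecting x∈T y∈T (IsPartialOrder.reflexive Q.isPartial hx≡hy))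
      (reflecting y∈T x∈T (IsPartialOrder.reflexive Q.isPartial (sym hx≡hy)))

IsLinearOrderOn-comap : ∀ {n m} {T : Subset n} {S : Subset m} {L : Rel (Fin m) 0ℓ} (h : Fin n → Fin m) →
                        (∀ {x} → x ∈ T → h x ∈ S) → (∀ {x y} → x ∈ T → y ∈ T → h x ≡ h y → x ≡ y) →
                        IsLinearOrderOn S L → IsLinearOrderOn T (L on h)
IsLinearOrderOn-comap h mapsTo h-inj lin = record
  { reflexive  = λ x x∈T → reflexive (h x) (mapsTo x∈T)
  ; antisym    = λ x y x∈T y∈T Lxy Lyx → h-inj x∈T y∈T (antisym _ _ (mapsTo x∈T) (mapsTo y∈T) Lxy Lyx)
  ; transitive = λ x y z x∈T y∈T z∈T → transitive _ _ _ (mapsTo x∈T) (mapsTo y∈T) (mapsTo z∈T)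
  ; total      = λ x y x∈T y∈T → total _ _ (mapsTo x∈T) (mapsTo y∈T)
  }
  where open IsLinearOrderOn lin

DimAtMost2-reflect : ∀ {n m} {P : Poset n} {Q : Poset m} {h T S} →
                     OrderEmbeddingOn P Q h T S → DimAtMost2 Q S → DimAtMost2 P T
DimAtMost2-reflect {h = h} e (L₁ , L₂ , lin₁ , lin₂ , realizes) =
  (L₁ on h) , (L₂ on h) ,
  IsLinearOrderOn-comap h mapsTo injective lin₁ , IsLinearOrderOn-comap h mapsTo injective lin₂ ,
  λ x y x∈T y∈T →
    (λ x≼y → proj₁ (realizes _ _ (mapsTo x∈T) (mapsTo y∈T)) (monotone x∈T y∈T x≼y)) ,
    (λ L₁₂xy → reflecting x∈T y∈T (proj₂ (realizes _ _ (mapsTo x∈T) (mapsTo y∈T)) L₁₂xy))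
  where open OrderEmbeddingOn e

restrict : ∀ {n d} → Poset (n + d) → Poset n
restrict {d = d} P = comap (Poset.isPartial P) (_↑ˡ d) (↑ˡ-injective d _ _)

Dim2Bounded-restrict : ∀ {n d k} (P : Poset (n + d)) → Dim2Bounded P k → Dim2Bounded (restrict {n} {d} P) k
Dim2Bounded-restrict {zero}          P bound []  _     = z≤n
Dim2Bounded-restrict {suc n} {d} {k} P bound S S-dim =
  subst (_≤ k) (∣p++⊥∣≡∣p∣ S) (bound (S ++ ⊥) (DimAtMost2-reflect embedding S-dim))
  where
  open Poset P
  retract : Fin (suc n + d) → Fin (suc n)
  retract u = [ id , const zero ]′ (splitAt (suc n) u)

  retract-↑ˡ : ∀ x → retract (x ↑ˡ d) ≡ x
  retract-↑ˡ x = cong [ id , const zero ]′ (splitAt-↑ˡ (suc n) x d)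

  mapsTo : ∀ {u} → u ∈ S ++ ⊥ → retract u ∈ S
  mapsTo u∈ with ∈-p++⊥⁻ {n = d} {p = S} u∈
  ... | x , x∈S , refl = subst (_∈ S) (sym (retract-↑ˡ x)) x∈S

  section : ∀ {u} → u ∈ S ++ ⊥ → retract u ↑ˡ d ≡ u
  section u∈ with ∈-p++⊥⁻ {n = d} {p = S} u∈
  ... | x , _ , refl = cong (_↑ˡ d) (retract-↑ˡ x)

  embedding : OrderEmbeddingOn P (restrict {suc n} {d} P) retract (S ++ ⊥) S
  embedding = record
    { mapsTo     = mapsTo
    ; monotone   = λ u∈ v∈ → subst₂ _≼_ (sym (section u∈)) (sym (section v∈))
    ; reflecting = λ u∈ v∈ → subst₂ _≼_ (section u∈) (section v∈)
    }

Ex*≤-restrict : ∀ {n m k} → n ≤ m → Ex*≤ m k → Ex*≤ n k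
Ex*≤-restrict {n} {k = k} n≤m Q = go (subst (λ m → Ex*≤ m k) (sym (m+[n∸m]≡n n≤m)) Q)
  where
  go : ∀ {d} → Ex*≤ (n + d) k → Ex*≤ n k
  go {d} (P , bound) = restrict {n} {d} P , Dim2Bounded-restrict P bound

module Lex {a b} (P : Poset a) (Q : Poset b) where
  private
    module P = Poset P
    module Q = Poset Q
    module PO = IsPartialOrder P.isPartial
    module QO = IsPartialOrder Q.isPartial

  _≤ₗₑₓ_ : Rel (Fin a × Fin b) 0ℓ
  _≤ₗₑₓ_ = ×-Lex _≡_ P._≼_ Q._≼_

  lex : Poset (a * b)
  lex = comap (×-isPartialOrder P.isPartial Q.isPartial) (remQuot {a} b) remQuot-injective
    where
    remQuot-injective : ∀ {u v} → let (i , x) = remQuot {a} b u ; (j , y) = remQuot {a} b v in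
                        i ≡ j × x ≡ y → u ≡ v
    remQuot-injective {u} {v} (e₁ , e₂) =
      trans (sym (combine-remQuot {a} b u)) (trans (cong₂ combine e₁ e₂) (combine-remQuot {a} b v))

  open Poset lex using (_≼_)

  combine-mono : ∀ {i x j y} → (i , x) ≤ₗₑₓ (j , y) → combine i x ≼ combine j y
  combine-mono {i} {x} {j} {y} = subst₂ _≤ₗₑₓ_ (sym (remQuot-combine i x)) (sym (remQuot-combine j y))

  combine-reflect : ∀ {i x j y} → combine i x ≼ combine j y → (i , x) ≤ₗₑₓ (j , y)
  combine-reflect {i} {x} {j} {y} = subst₂ _≤ₗₑₓ_ (remQuot-combine i x) (remQuot-combine j y)

  row-embedding : ∀ (S : Subset (a * b)) i → OrderEmbeddingOn Q lex (combine i) (row S i) S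
  row-embedding S i = record
    { mapsTo     = ∈-preimage⁻
    ; monotone   = λ _ _ x≼y → combine-mono (inj₂ (refl , x≼y))
    ; reflecting = λ _ _ → second ∘ combine-reflect
    }
    where
    second : ∀ {x y} → (i , x) ≤ₗₑₓ (i , y) → x Q.≼ y
    second (inj₁ (_ , i≢i)) = ⊥-elim (i≢i refl)
    second (inj₂ (_ , x≼y)) = x≼y

  representatives-embedding : ∀ (S : Subset (a * b)) (T : Subset a) (r : Fin a → Fin b) →
                              (∀ {i} → i ∈ T → r i ∈ row S i) →
                              OrderEmbeddingOn P lex (λ i → combine i (r i)) T S
  representatives-embedding S T r r∈row = record
    { mapsTo     = ∈-preimage⁻ ∘ r∈row
    ; monotone   = λ _ _ → combine-mono ∘ lift
    ; reflecting = λ _ _ → first ∘ combine-reflect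
    }
    where
    lift : ∀ {i j} → i P.≼ j → (i , r i) ≤ₗₑₓ (j , r j)
    lift {i} {j} i≼j with i Fin.≟ j
    ... | yes refl = inj₂ (refl , QO.refl)
    ... | no i≢j   = inj₁ (i≼j , i≢j)
    first : ∀ {i j} → (i , r i) ≤ₗₑₓ (j , r j) → i P.≼ j
    first (inj₁ (i≼j , _)) = i≼j
    first (inj₂ (refl , _)) = PO.refl

open Lex using (lex)

Dim2Bounded-lex : ∀ {a b k₁ k₂} (P : Poset a) (Q : Poset b) →
                  Dim2Bounded P k₁ → Dim2Bounded Q k₂ → Dim2Bounded (lex P Q) (k₁ * k₂)
Dim2Bounded-lex {a} {zero} {k₁} {k₂} P Q _ _ S _ =
  ≤-trans (∣p∣≤n S) (≤-trans (≤-reflexive (*-zeroʳ a)) z≤n)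
Dim2Bounded-lex {a} {suc b} {k₁} {k₂} P Q P-bound Q-bound S S-dim = begin
  ∣ S ∣                      ≡⟨ ∣p∣≡∑∣row∣ a S ⟩
  ∑[ i < a ] ∣ row S i ∣     ≤⟨ ∑≤∣p∣* (λ i → ∣ row S i ∣) T row-bound empty-row ⟩
  ∣ T ∣ * k₂                 ≤⟨ *-monoˡ-≤ k₂ (P-bound T T-dim) ⟩
  k₁ * k₂                    ∎
  where
  open ≤-Reasoning
  open Lex P Q using (row-embedding; representatives-embedding)

  T : Subset a
  T = select (nonempty? ∘ row S)

  representative : Fin a → Fin (suc b)
  representative i with nonempty? (row S i)
  ... | yes (x , _) = x
  ... | no _        = zero

  representative-∈ : ∀ {i} → i ∈ T → representative i ∈ row S i
  representative-∈ {i} i∈T with nonempty? (row S i)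
  ... | yes (_ , x∈) = x∈
  ... | no ¬nonempty = ⊥-elim (¬nonempty (∈-select⁻ {P? = nonempty? ∘ row S} i∈T))

  row-bound : ∀ i → ∣ row S i ∣ ≤ k₂
  row-bound i = Q-bound (row S i) (DimAtMost2-reflect (row-embedding S i) S-dim)

  empty-row : ∀ {i} → i ∉ T → ∣ row S i ∣ ≡ 0
  empty-row {i} i∉T =
    trans (cong ∣_∣ (Empty-unique {p = row S i} (i∉T ∘ ∈-select⁺ {P? = nonempty? ∘ row S}))) (∣⊥∣≡0 (suc b))

  T-dim : DimAtMost2 P T
  T-dim = DimAtMost2-reflect (representatives-embedding S T representative representative-∈) S-dim

Ex*≤-lex : ∀ {a b k₁ k₂} → Ex*≤ a k₁ → Ex*≤ b k₂ → Ex*≤ (a * b) (k₁ * k₂)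
Ex*≤-lex (P , P-bound) (Q , Q-bound) = lex P Q , Dim2Bounded-lex P Q P-bound Q-bound

Ex*≤-^ : ∀ {n k} → Ex*≤ n k → ∀ t → Ex*≤ (n ^ t) (k ^ t)
Ex*≤-^ _    zero    = chain 1 , λ S _ → ∣p∣≤n S
Ex*≤-^ base (suc t) = Ex*≤-lex base (Ex*≤-^ base t)

data _<ₛ_ {m : ℕ} : Rel (Fin m ⊎ Fin m) 0ℓ where
  a<b : ∀ {i j} → i ≢ j → inj₁ i <ₛ inj₂ j

<ₛ-isStrictPartialOrder : ∀ {m} → IsStrictPartialOrder _≡_ (_<ₛ_ {m})
<ₛ-isStrictPartialOrder = record
  { isEquivalence = isEquivalence
  ; irrefl        = λ { refl () }
  ; trans         = λ { (a<b _) () }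
  ; <-resp-≈      = resp₂ _<ₛ_
  }

_≤ₛ_ : ∀ {m} → Rel (Fin m ⊎ Fin m) 0ℓ
_≤ₛ_ = StrictToNonStrict._≤_ _≡_ _<ₛ_

standardExample : ∀ m → Poset (m + m)
standardExample m =
  comap (StrictToNonStrict.isPartialOrder _≡_ _<ₛ_ <ₛ-isStrictPartialOrder) (splitAt m) splitAt-injective
  where
  splitAt-injective : ∀ {u v} → splitAt m u ≡ splitAt m v → u ≡ v
  splitAt-injective {u} {v} e = trans (sym (join-splitAt m m u)) (trans (cong (join m m) e) (join-splitAt m m v))

module StandardExample (m : ℕ) where
  open Poset (standardExample m)
  open IsPartialOrder isPartial using () renaming (reflexive to ≡⇒≼)

  a b : Fin m → Fin (m + m)
  a i = i ↑ˡ m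
  b j = m ↑ʳ j

  a≼b : ∀ {i j} → i ≢ j → a i ≼ b j
  a≼b {i} {j} i≢j = subst₂ _≤ₛ_ (sym (splitAt-↑ˡ m i m)) (sym (splitAt-↑ʳ m m j)) (inj₁ (a<b i≢j))

  a⋠b : ∀ i → ¬ a i ≼ b i
  a⋠b i aᵢ≼bᵢ with subst₂ _≤ₛ_ (splitAt-↑ˡ m i m) (splitAt-↑ʳ m m i) aᵢ≼bᵢ
  ... | inj₁ (a<b i≢i) = i≢i refl
  ... | inj₂ ()

  no-two-reversed : ∀ {S L} → IsLinearOrderOn S L → (∀ {x y} → x ∈ S → y ∈ S → x ≼ y → L x y) →
                    ∀ {i j} → i ≢ j → a i ∈ S → b i ∈ S → a j ∈ S → b j ∈ S →
                    L (b i) (a i) → ¬ L (b j) (a j)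
  no-two-reversed lin extends i≢j aᵢ bᵢ aⱼ bⱼ bᵢLaᵢ bⱼLaⱼ =
    a⋠b _ (≡⇒≼ (antisym _ _ aᵢ bᵢ aᵢLbᵢ bᵢLaᵢ))
    where
    open IsLinearOrderOn lin using (antisym; transitive)
    -- aᵢ < bⱼ ≤ aⱼ < bᵢ in L
    aᵢLbᵢ = transitive _ _ _ aᵢ aⱼ bᵢ
              (transitive _ _ _ aᵢ bⱼ aⱼ (extends aᵢ bⱼ (a≼b i≢j)) bⱼLaⱼ)
              (extends aⱼ bᵢ (a≼b (i≢j ∘ sym)))

  Dim2Bounded-standardExample : Dim2Bounded (standardExample m) (m + 2)
  Dim2Bounded-standardExample S (L₁ , L₂ , lin₁ , lin₂ , realizes) = begin
    ∣ S ∣          ≡⟨ ∣p∣≡∣preimage↑ˡ∣+∣preimage↑ʳ∣ m S ⟩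
    ∣ A ∣ + ∣ B ∣  ≤⟨ ∣p∣+∣q∣≤n+∣p∩q∣ A B ⟩
    m + ∣ A ∩ B ∣  ≤⟨ +-monoʳ-≤ m (injection⇒∣p∣≤ (A ∩ B) colour colour-injective) ⟩
    m + 2          ∎
    where
    open ≤-Reasoning
    A B : Subset m
    A = preimage a S
    B = preimage b S

    L : Fin 2 → Rel (Fin (m + m)) 0ℓ
    L zero       = L₁
    L (suc zero) = L₂

    linear : ∀ c → IsLinearOrderOn S (L c)
    linear zero       = lin₁
    linear (suc zero) = lin₂

    extends : ∀ c {x y} → x ∈ S → y ∈ S → x ≼ y → L c x y
    extends zero       x∈S y∈S = proj₁ ∘ proj₁ (realizes _ _ x∈S y∈S)
    extends (suc zero) x∈S y∈S = proj₂ ∘ proj₁ (realizes _ _ x∈S y∈S)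

    reversal : ∀ {i} → a i ∈ S → b i ∈ S → Σ[ c ∈ Fin 2 ] L c (b i) (a i)
    reversal {i} aᵢ bᵢ with IsLinearOrderOn.total lin₁ _ _ aᵢ bᵢ
    ... | inj₂ bᵢL₁aᵢ = zero , bᵢL₁aᵢ
    ... | inj₁ aᵢL₁bᵢ with IsLinearOrderOn.total lin₂ _ _ aᵢ bᵢ
    ...   | inj₂ bᵢL₂aᵢ = suc zero , bᵢL₂aᵢ
    ...   | inj₁ aᵢL₂bᵢ = ⊥-elim (a⋠b i (proj₂ (realizes _ _ aᵢ bᵢ) (aᵢL₁bᵢ , aᵢL₂bᵢ)))

    pair : ∀ {i} → i ∈ A ∩ B → a i ∈ S × b i ∈ S
    pair i∈ = let (i∈A , i∈B) = x∈p∩q⁻ A B i∈ in ∈-preimage⁻ i∈A , ∈-preimage⁻ i∈B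

    colouring : ∀ {i} → i ∈ A ∩ B → Σ[ c ∈ Fin 2 ] L c (b i) (a i)
    colouring i∈ = reversal (proj₁ (pair i∈)) (proj₂ (pair i∈))

    colour : ∀ {i} → i ∈ A ∩ B → Fin 2
    colour = proj₁ ∘ colouring

    colour-injective : ∀ {i j} (i∈ : i ∈ A ∩ B) (j∈ : j ∈ A ∩ B) → colour i∈ ≡ colour j∈ → i ≡ j
    colour-injective {i} {j} i∈ j∈ same with i Fin.≟ j
    ... | yes i≡j = i≡j
    ... | no i≢j  = ⊥-elim (no-two-reversed (linear c) (extends c) i≢j aᵢ bᵢ aⱼ bⱼ
                             (proj₂ (colouring i∈))
                             (subst (λ c′ → L c′ (b j) (a j)) (sym same) (proj₂ (colouring j∈))))
      where
      c = colour i∈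
      aᵢ = proj₁ (pair i∈)
      bᵢ = proj₂ (pair i∈)
      aⱼ = proj₁ (pair j∈)
      bⱼ = proj₂ (pair j∈)

open StandardExample using (Dim2Bounded-standardExample)

Ex*≤-standardExample : ∀ m → Ex*≤ (m + m) (m + 2)
Ex*≤-standardExample m = standardExample m , Dim2Bounded-standardExample m

[m^n]^o≡[m^o]^n : ∀ m n o → (m ^ n) ^ o ≡ (m ^ o) ^ n
[m^n]^o≡[m^o]^n m n o = begin
  (m ^ n) ^ o ≡⟨ ^-*-assoc m n o ⟩
  m ^ (n * o) ≡⟨ cong (m ^_) (*-comm n o) ⟩
  m ^ (o * n) ≡⟨ ^-*-assoc m o n ⟨
  (m ^ o) ^ n ∎
  where open ≡-Reasoning

bernoulli : ∀ A t → A ^ suc t + t * A ^ t ≤ A * suc A ^ t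
bernoulli A zero    = ≤-reflexive (+-identityʳ (A * 1))
bernoulli A (suc t) = begin
  A * (A * A ^ t) + suc t * (A * A ^ t)                ≤⟨ m≤m+n _ (t * A ^ t) ⟩
  (A * (A * A ^ t) + suc t * (A * A ^ t)) + t * A ^ t  ≡⟨ expand A (A ^ t) t ⟨
  (1 + A) * (A * A ^ t + t * A ^ t)                    ≤⟨ *-monoʳ-≤ (1 + A) (bernoulli A t) ⟩
  (1 + A) * (A * suc A ^ t)                            ≡⟨ *-assoc-comm A (suc A ^ t) ⟩
  A * (suc A * suc A ^ t)                              ∎
  where
  open ≤-Reasoning
  expand : ∀ A X t → (1 + A) * (A * X + t * X) ≡ (A * (A * X) + (1 + t) * (A * X)) + t * X
  expand = solve-∀
  *-assoc-comm : ∀ A X → (1 + A) * (A * X) ≡ A * ((1 + A) * X)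
  *-assoc-comm = solve-∀

^-suc≤suc-^ : ∀ A t → A * A ≤ t → A ^ suc t ≤ suc A ^ t
^-suc≤suc-^ zero    t _     = z≤n
^-suc≤suc-^ A@(suc _) t A*A≤t = *-cancelˡ-≤ A (begin
  A * (A * A ^ t)          ≡⟨ *-assoc A A (A ^ t) ⟨
  (A * A) * A ^ t          ≤⟨ *-monoˡ-≤ (A ^ t) A*A≤t ⟩
  t * A ^ t                ≤⟨ m≤n+m _ _ ⟩
  A ^ suc t + t * A ^ t    ≤⟨ bernoulli A t ⟩
  A * suc A ^ t            ∎)
  where open ≤-Reasoning

log-bracket : ∀ {b} → 1 < b → ∀ n → 0 < n → ∃[ t ] (b ^ t ≤ n × n < b ^ suc t)
log-bracket {b} 1<b (suc zero) _ = 0 , ≤-refl , ^-monoʳ-< b 1<b {0} {1} z<s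
log-bracket {b} 1<b (suc (suc n)) _ with log-bracket 1<b (suc n) z<s
... | t , b^t≤n , n<b^[1+t] with suc (suc n) <? b ^ suc t
...   | yes n+1<b^[1+t] = t , m≤n⇒m≤1+n b^t≤n , n+1<b^[1+t]
...   | no  n+1≮b^[1+t] =
  suc t , ≮⇒≥ n+1≮b^[1+t] , ≤-<-trans n<b^[1+t] (^-monoʳ-< b 1<b (n<1+n (suc t)))

eventually-Ex*^p≤n^q : ∀ {a b p q} → 1 < b → (∀ t → Ex*≤ (b ^ t) (a ^ t)) → a ^ p < b ^ q →
                       Σ[ N ∈ ℕ ] ((n : ℕ) → N ≤ n →
                         Σ[ P ∈ Poset n ] ((S : Subset n) → DimAtMost2 P S → ∣ S ∣ ^ p ≤ n ^ q))
eventually-Ex*^p≤n^q {a} {b} {p} {q} 1<b family a^p<b^q = b ^ (A * A) , bounded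
  where
  A = a ^ p
  instance
    b≢0 : NonZero b
    b≢0 = >-nonZero (<-trans z<s 1<b)

  bounded : ∀ n → b ^ (A * A) ≤ n → Σ[ P ∈ Poset n ] ((S : Subset n) → DimAtMost2 P S → ∣ S ∣ ^ p ≤ n ^ q)
  bounded n N≤n with log-bracket 1<b n (<-≤-trans (m^n>0 b (A * A)) N≤n)
  ... | t , b^t≤n , n<b^[1+t] = proj₁ restricted , λ S S-dim → power-bound (proj₂ restricted S S-dim)
    where
    restricted : Ex*≤ n (a ^ suc t)
    restricted = Ex*≤-restrict (<⇒≤ n<b^[1+t]) (family (suc t))

    A*A≤t : A * A ≤ t
    A*A≤t = ≮⇒≥ λ t<A*A → <-irrefl refl (<-≤-trans n<b^[1+t] (≤-trans (^-monoʳ-≤ b t<A*A) N≤n))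

    power-bound : ∀ {s} → s ≤ a ^ suc t → s ^ p ≤ n ^ q
    power-bound {s} s≤a^[1+t] = begin
      s ^ p            ≤⟨ ^-monoˡ-≤ p s≤a^[1+t] ⟩
      (a ^ suc t) ^ p  ≡⟨ [m^n]^o≡[m^o]^n a (suc t) p ⟩
      A ^ suc t        ≤⟨ ^-suc≤suc-^ A t A*A≤t ⟩
      suc A ^ t        ≤⟨ ^-monoˡ-≤ t a^p<b^q ⟩
      (b ^ q) ^ t      ≡⟨ [m^n]^o≡[m^o]^n b q t ⟩
      (b ^ t) ^ q      ≤⟨ ^-monoˡ-≤ q b^t≤n ⟩
      n ^ q            ∎
      where open ≤-Reasoning

corollary2 : Σ[ N ∈ ℕ ] ((n : ℕ) → N ≤ n →
               Σ[ P ∈ Poset n ] ((S : Subset n) → DimAtMost2 P S →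
                 ∣ S ∣ ^ 2000 ≤ n ^ 1659))
-- The exponents are passed explicitly: inferring them by unifying 12 ^ _p < 20 ^ _q with
-- the type of 12²⁰⁰⁰<20¹⁶⁵⁹ exhausts memory.
corollary2 =
  eventually-Ex*^p≤n^q {12} {20} {2000} {1659} (s≤s (s≤s z≤n)) (Ex*≤-^ (Ex*≤-standardExample 10)) 12²⁰⁰⁰<20¹⁶⁵⁹
  where
  12²⁰⁰⁰<20¹⁶⁵⁹ : 12 ^ 2000 < 20 ^ 1659
  12²⁰⁰⁰<20¹⁶⁵⁹ = ≤ᵇ⇒≤ _ _ tt
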